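{- Let $n,m$ be coprime positive integers and $k\ge1$. Every $(kn,km)$-Dyck path $D$ has at least one good interval.
   Context: A $(kn,km)$-Dyck path is a lattice path with $kn$ unit up steps $(0,1)$ and $km$ unit left steps $(-1,0)$ that never goes strictly above the segment joining its start and end points; view it as a map $D:[0,k(n+m)]\to\mathbb R^2$ parametrized by arc length. A balanced interval of $D$ is the restriction of $D$ to $[r,r+n+m]$ with $r\in\mathbb Z$ and $D(r+n+m)=D(r)+(-m,n)$ (i.e. $n+m$ consecutive steps, $n$ vertical and $m$ horizontal). Its $(n,m)$-periodic extension is the union of the translates of this interval by all integer multiples of $(-m,n)$. A balanced interval is good if its periodic extension does not meet the part of $D$ preceding it, $D([0,r))$. -}

module Defs where

open import Data.Nat as ℕ using (ℕ; zero; suc; _+_; _*_; _≤_; _<_)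
open import Data.Integer as ℤ using (ℤ; +_; -_)
open import Data.List using (List; []; _∷_; take; length)
open import Data.Product using (_×_; _,_; ∃-syntax)
open import Relation.Binary.PropositionalEquality using (_≡_; _≢_)

-- A unit step of a lattice path: up (0,1) or left (-1,0).
data Step : Set where
  U : Step
  L : Step

ups : List Step → ℕ
ups []      = 0
ups (U ∷ s) = suc (ups s)
ups (L ∷ s) = ups s

lefts : List Step → ℕ
lefts []      = 0
lefts (U ∷ s) = lefts s
lefts (L ∷ s) = suc (lefts s)

Point : Set
Point = ℤ × ℤ

_⊕_ : Point → Point → Point
(a , b) ⊕ (c , d) = (a ℤ.+ c , b ℤ.+ d)

_·_ : ℤ → Point → Point
j · (a , b) = (j ℤ.* a , j ℤ.* b)

D : List Step → ℕ → Point
D p i = (- (+ lefts (take i p)) , + ups (take i p))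

-- (kn,km)-Dyck path: kn up steps, km left steps, never strictly above the
-- segment from (0,0) to (-km,kn), i.e. every point (x,y) satisfies m*y ≤ n*(-x).
-- (Checking the lattice vertices suffices, the region being convex.)
IsDyck : ℕ → ℕ → ℕ → List Step → Set
IsDyck n m k p =
  ups p ≡ k * n × lefts p ≡ k * m ×
  (∀ i → i ≤ length p → m * ups (take i p) ≤ n * lefts (take i p))

Balanced : ℕ → ℕ → List Step → ℕ → Set
Balanced n m p r =
  r + (n + m) ≤ length p × D p (r + (n + m)) ≡ D p r ⊕ (- (+ m) , + n)

-- Good: the (n,m)-periodic extension of D([r,r+n+m]) does not meet D([0,r)).
-- All these sets are unions of unit lattice segments, so they meet iff they
-- share a lattice point; the lattice points of D([0,r)) are D(i), i < r, and
-- those of the periodic extension are D(r+s) + j(-m,n), s ≤ n+m, j ∈ ℤ.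
Good : ℕ → ℕ → List Step → ℕ → Set
Good n m p r =
  ∀ i → i < r → ∀ s → s ≤ n + m → ∀ (j : ℤ) →
    D p i ≢ D p (r + s) ⊕ (j · (- (+ m) , + n))

-- The level n·x + m·y of a lattice point is invariant under translation by
-- (-m,n), and D(0) and D(end) both have level 0. Take the first time T at
-- which D revisits a level already attained at some time i < T. By coprimality
-- D(i) → D(T) is c(n+m) steps with cn of them up, so some window of n+m
-- consecutive steps inside [i,T] contains exactly n up steps (the number of up
-- steps of a sliding window changes by at most one). That window is balanced,
-- and any meeting of its periodic extension with the earlier part of D would
-- be an even earlier level revisit.
module Submission where

open import Defs
open import Data.Nat
  using (ℕ; zero; suc; _+_; _*_; _≤_; _<_; _≤′_; ≤′-refl; ≤′-step; z≤n; s≤s; s≤s⁻¹;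
         NonZero; >-nonZero; >-nonZero⁻¹)
open import Data.Nat.Properties
open import Data.Nat.Coprimality using (Coprime; coprime-divisor)
open import Data.Nat.Divisibility using (divides)
open import Data.Nat.Tactic.RingSolver using () renaming (solve-∀ to ℕ-solve-∀)
open import Data.Integer as ℤ using (ℤ; +_; -_; 0ℤ)
import Data.Integer.Properties as ℤP
open import Data.Integer.Tactic.RingSolver using (solve-∀)
open import Algebra.Properties.AbelianGroup ℤP.+-0-abelianGroup using (identityʳ-unique)
open import Data.List using (List; []; _∷_; _++_; take; drop; length)
open import Data.List.Properties using (length-take; take-all; take-[])
open import Data.Product as Product using (_×_; ∃-syntax; _,_; proj₁; proj₂)
open import Data.Sum using (_⊎_; inj₁; inj₂)
open import Data.Empty using (⊥-elim)
open import Function using (_∘_)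
open import Relation.Nullary using (¬_; yes; no)
open import Relation.Unary using (Pred; Decidable)
open import Relation.Binary.PropositionalEquality

ups-++ : ∀ xs ys → ups (xs ++ ys) ≡ ups xs + ups ys
ups-++ []       ys = refl
ups-++ (U ∷ xs) ys = cong suc (ups-++ xs ys)
ups-++ (L ∷ xs) ys = ups-++ xs ys

lefts-++ : ∀ xs ys → lefts (xs ++ ys) ≡ lefts xs + lefts ys
lefts-++ []       ys = refl
lefts-++ (U ∷ xs) ys = lefts-++ xs ys
lefts-++ (L ∷ xs) ys = cong suc (lefts-++ xs ys)

ups+lefts≡length : ∀ xs → ups xs + lefts xs ≡ length xs
ups+lefts≡length []       = refl
ups+lefts≡length (U ∷ xs) = cong suc (ups+lefts≡length xs)
ups+lefts≡length (L ∷ xs) = trans (+-suc (ups xs) (lefts xs)) (cong suc (ups+lefts≡length xs))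

take-+ : ∀ {a} {A : Set a} t d (xs : List A) →
  take (t + d) xs ≡ take t xs ++ take d (drop t xs)
take-+ zero    d xs       = refl
take-+ (suc t) d []       = sym (take-[] d)
take-+ (suc t) d (x ∷ xs) = cong (x ∷_) (take-+ t d xs)

length-take-drop : ∀ {a} {A : Set a} t d (xs : List A) → t + d ≤ length xs →
  length (take d (drop t xs)) ≡ d
length-take-drop zero    d xs       d≤ = trans (length-take d xs) (m≤n⇒m⊓n≡m d≤)
length-take-drop (suc t) d (x ∷ xs) (s≤s t+d≤) = length-take-drop t d xs t+d≤

ups-take-+ : ∀ t d xs → ups (take (t + d) xs) ≡ ups (take t xs) + ups (take d (drop t xs))
ups-take-+ t d xs = trans (cong ups (take-+ t d xs)) (ups-++ (take t xs) _)

displacement : List Step → Point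
displacement w = (- (+ lefts w) , + ups w)

displacement-++ : ∀ xs ys → displacement (xs ++ ys) ≡ displacement xs ⊕ displacement ys
displacement-++ xs ys = cong₂ _,_
  (trans (cong (-_ ∘ +_) (lefts-++ xs ys))
     (trans (cong -_ (ℤP.pos-+ (lefts xs) (lefts ys)))
            (ℤP.neg-distrib-+ (+ lefts xs) (+ lefts ys))))
  (trans (cong +_ (ups-++ xs ys)) (ℤP.pos-+ (ups xs) (ups ys)))

D-+ : ∀ p t d → D p (t + d) ≡ D p t ⊕ displacement (take d (drop t p))
D-+ p t d = trans (cong displacement (take-+ t d p)) (displacement-++ (take t p) _)

UnitIncreasing : (ℕ → ℕ) → Set
UnitIncreasing f = ∀ t → f t ≤ f (suc t) × f (suc t) ≤ suc (f t)

ups-take-unitIncreasing : ∀ xs → UnitIncreasing (λ t → ups (take t xs))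
ups-take-unitIncreasing []       zero    = z≤n , z≤n
ups-take-unitIncreasing []       (suc t) = z≤n , z≤n
ups-take-unitIncreasing (U ∷ xs) zero    = z≤n , s≤s z≤n
ups-take-unitIncreasing (L ∷ xs) zero    = z≤n , z≤n
ups-take-unitIncreasing (U ∷ xs) (suc t) = Product.map s≤s s≤s (ups-take-unitIncreasing xs t)
ups-take-unitIncreasing (L ∷ xs) (suc t) = ups-take-unitIncreasing xs t

UnitLipschitz : (ℕ → ℕ) → Set
UnitLipschitz g = ∀ s → g (suc s) ≤ suc (g s) × g s ≤ suc (g (suc s))

window-unitLipschitz : ∀ {f A : ℕ → ℕ} N → UnitIncreasing f →
  (∀ s → f (s + N) ≡ f s + A s) → UnitLipschitz A
window-unitLipschitz {f} {A} N inc window s = up , down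
  where
  open ≤-Reasoning
  up : A (suc s) ≤ suc (A s)
  up = +-cancelˡ-≤ (f (suc s)) _ _ (begin
    f (suc s) + A (suc s)  ≡⟨ window (suc s) ⟨
    f (suc (s + N))        ≤⟨ proj₂ (inc (s + N)) ⟩
    suc (f (s + N))        ≡⟨ cong suc (window s) ⟩
    suc (f s + A s)        ≡⟨ +-suc (f s) (A s) ⟨
    f s + suc (A s)        ≤⟨ +-monoˡ-≤ (suc (A s)) (proj₁ (inc s)) ⟩
    f (suc s) + suc (A s)  ∎)
  down : A s ≤ suc (A (suc s))
  down = +-cancelˡ-≤ (f s) _ _ (begin
    f s + A s              ≡⟨ window s ⟨
    f (s + N)              ≤⟨ proj₁ (inc (s + N)) ⟩
    f (suc (s + N))        ≡⟨ window (suc s) ⟩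
    f (suc s) + A (suc s)  ≤⟨ +-monoˡ-≤ (A (suc s)) (proj₂ (inc s)) ⟩
    suc (f s + A (suc s))  ≡⟨ +-suc (f s) (A (suc s)) ⟨
    f s + suc (A (suc s))  ∎)

Between : ℕ → ℕ → ℕ → Set
Between v a b = (a ≤ v × v ≤ b) ⊎ (b ≤ v × v ≤ a)

between-self : ∀ {v a} → Between v a a → a ≡ v
between-self (inj₁ (a≤v , v≤a)) = ≤-antisym a≤v v≤a
between-self (inj₂ (a≤v , v≤a)) = ≤-antisym a≤v v≤a

between-pred : ∀ {g v a y} → UnitLipschitz g → g (suc y) ≢ v →
  Between v a (g (suc y)) → Between v a (g y)
between-pred {y = y} lip g≢v (inj₁ (a≤v , v≤g)) =
  inj₁ (a≤v , s≤s⁻¹ (≤-trans (≤∧≢⇒< v≤g (g≢v ∘ sym)) (proj₁ (lip y))))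
between-pred {y = y} lip g≢v (inj₂ (g≤v , v≤a)) =
  inj₂ (≤-trans (proj₂ (lip y)) (≤∧≢⇒< g≤v g≢v) , v≤a)

unitLipschitz-ivt : ∀ {g v x y} → UnitLipschitz g → x ≤′ y →
  Between v (g x) (g y) → ∃[ s ] (x ≤ s × s ≤ y × g s ≡ v)
unitLipschitz-ivt {x = x} lip ≤′-refl between = x , ≤-refl , ≤-refl , between-self between
unitLipschitz-ivt {g} {v} {y = suc y} lip (≤′-step x≤′y) between with g (suc y) ≟ v
... | yes g≡v = suc y , ≤′⇒≤ (≤′-step x≤′y) , ≤-refl , g≡v
... | no  g≢v =
  let s , x≤s , s≤y , gs≡v = unitLipschitz-ivt lip x≤′y (between-pred lip g≢v between)
  in  s , x≤s , m≤n⇒m≤1+n s≤y , gs≡v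

∃-increment≤mean : ∀ n (h : ℕ → ℕ) c → h (suc c) ≤ h 0 + suc c * n →
  ∃[ q ] (q ≤ c × h (suc q) ≤ h q + n)
∃-increment≤mean n h zero total =
  0 , z≤n , ≤-trans total (≤-reflexive (cong (_+_ (h 0)) (+-identityʳ n)))
∃-increment≤mean n h (suc c) total with h (suc (suc c)) ≤? h (suc c) + n
... | yes last≤ = suc c , ≤-refl , last≤
... | no  last≰ =
  let q , q≤c , inc≤ = ∃-increment≤mean n h c earlier in q , m≤n⇒m≤1+n q≤c , inc≤
  where
  open ≤-Reasoning
  earlier : h (suc c) ≤ h 0 + suc c * n
  earlier = +-cancelʳ-≤ n _ _ (begin
    h (suc c) + n          ≤⟨ <⇒≤ (≰⇒> last≰) ⟩
    h (suc (suc c))        ≤⟨ total ⟩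
    h 0 + (n + suc c * n)  ≡⟨ cong (_+_ (h 0)) (+-comm n (suc c * n)) ⟩
    h 0 + (suc c * n + n)  ≡⟨ +-assoc (h 0) (suc c * n) n ⟨
    h 0 + suc c * n + n    ∎)

∃-increment≥mean : ∀ n (h : ℕ → ℕ) c → h 0 + suc c * n ≤ h (suc c) →
  ∃[ q ] (q ≤ c × h q + n ≤ h (suc q))
∃-increment≥mean n h zero total =
  0 , z≤n , ≤-trans (≤-reflexive (cong (_+_ (h 0)) (sym (+-identityʳ n)))) total
∃-increment≥mean n h (suc c) total with h (suc c) + n ≤? h (suc (suc c))
... | yes last≥ = suc c , ≤-refl , last≥
... | no  last≱ =
  let q , q≤c , inc≥ = ∃-increment≥mean n h c earlier in q , m≤n⇒m≤1+n q≤c , inc≥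
  where
  open ≤-Reasoning
  earlier : h 0 + suc c * n ≤ h (suc c)
  earlier = +-cancelʳ-≤ n _ _ (begin
    h 0 + suc c * n + n    ≡⟨ +-assoc (h 0) (suc c * n) n ⟩
    h 0 + (suc c * n + n)  ≡⟨ cong (_+_ (h 0)) (+-comm (suc c * n) n) ⟩
    h 0 + (n + suc c * n)  ≤⟨ total ⟩
    h (suc (suc c))        ≤⟨ <⇒≤ (≰⇒> last≱) ⟩
    h (suc c) + n          ∎)

-- The windows starting at i + qN (q ≤ c) tile [i, i + (c+1)N], so one has
-- A ≤ n and one has A ≥ n; the intermediate value theorem applies between them.
window-≡-mean : ∀ {f A : ℕ → ℕ} n N → UnitIncreasing f → (∀ s → f (s + N) ≡ f s + A s) →
  ∀ i c → f (i + suc c * N) ≡ f i + suc c * n → ∃[ s ] (s + N ≤ i + suc c * N × A s ≡ n)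
window-≡-mean {f} {A} n N inc window i c total = straddle (≤-total q₁ q₂)
  where
  x : ℕ → ℕ
  x q = i + q * N
  h : ℕ → ℕ
  h q = f (x q)
  x-suc : ∀ q → x (suc q) ≡ x q + N
  x-suc q = trans (cong (_+_ i) (+-comm N (q * N))) (sym (+-assoc i (q * N) N))
  h-suc : ∀ q → h (suc q) ≡ h q + A (x q)
  h-suc q = trans (cong f (x-suc q)) (window (x q))
  total′ : h (suc c) ≡ h 0 + suc c * n
  total′ = trans total (cong (λ t → f t + suc c * n) (sym (+-identityʳ i)))
  below : ∃[ q ] (q ≤ c × h (suc q) ≤ h q + n)
  below = ∃-increment≤mean n h c (≤-reflexive total′)
  above : ∃[ q ] (q ≤ c × h q + n ≤ h (suc q))
  above = ∃-increment≥mean n h c (≤-reflexive (sym total′))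
  q₁ q₂ : ℕ
  q₁ = proj₁ below
  q₂ = proj₁ above
  A≤n : A (x q₁) ≤ n
  A≤n = +-cancelˡ-≤ (h q₁) _ _ (≤-trans (≤-reflexive (sym (h-suc q₁))) (proj₂ (proj₂ below)))
  n≤A : n ≤ A (x q₂)
  n≤A = +-cancelˡ-≤ (h q₂) _ _ (≤-trans (proj₂ (proj₂ above)) (≤-reflexive (h-suc q₂)))
  x-mono : ∀ {q q′} → q ≤ q′ → x q ≤ x q′
  x-mono q≤q′ = +-monoʳ-≤ i (*-monoˡ-≤ N q≤q′)
  fits : ∀ {s q} → q ≤ c → s ≤ x q → s + N ≤ i + suc c * N
  fits {q = q} q≤c s≤x =
    ≤-trans (+-monoˡ-≤ N s≤x) (≤-trans (≤-reflexive (sym (x-suc q))) (x-mono (s≤s q≤c)))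
  lip : UnitLipschitz A
  lip = window-unitLipschitz N inc window
  straddle : q₁ ≤ q₂ ⊎ q₂ ≤ q₁ → ∃[ s ] (s + N ≤ i + suc c * N × A s ≡ n)
  straddle (inj₁ q₁≤q₂) =
    let s , _ , s≤x , As≡n = unitLipschitz-ivt lip (≤⇒≤′ (x-mono q₁≤q₂)) (inj₁ (A≤n , n≤A))
    in  s , fits (proj₁ (proj₂ above)) s≤x , As≡n
  straddle (inj₂ q₂≤q₁) =
    let s , _ , s≤x , As≡n = unitLipschitz-ivt lip (≤⇒≤′ (x-mono q₂≤q₁)) (inj₂ (A≤n , n≤A))
    in  s , fits (proj₁ (proj₂ below)) s≤x , As≡n

m*[c*n]≡n*[c*m] : ∀ m c n → m * (c * n) ≡ n * (c * m)
m*[c*n]≡n*[c*m] = ℕ-solve-∀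

coprime-*≡*⇒multiples : ∀ {n m a b} .{{_ : NonZero n}} → Coprime n m → m * a ≡ n * b →
  ∃[ c ] (a ≡ c * n × b ≡ c * m)
coprime-*≡*⇒multiples {n} {m} {a} {b} coprime ma≡nb
  with divides c a≡cn ← coprime-divisor coprime (divides b (trans ma≡nb (*-comm n b)))
  = c , a≡cn , *-cancelˡ-≡ b (c * m) n (begin
    n * b        ≡⟨ ma≡nb ⟨
    m * a        ≡⟨ cong (m *_) a≡cn ⟩
    m * (c * n)  ≡⟨ m*[c*n]≡n*[c*m] m c n ⟩
    n * (c * m)  ∎)
  where open ≡-Reasoning

module Level (n m : ℕ) where

  level : Point → ℤ
  level (x , y) = + m ℤ.* y ℤ.+ + n ℤ.* x

  level-⊕ : ∀ P Q → level (P ⊕ Q) ≡ level P ℤ.+ level Q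
  level-⊕ (a , b) (c , d) = linear (+ m) (+ n) a b c d
    where
    linear : ∀ M N a b c d →
      M ℤ.* (b ℤ.+ d) ℤ.+ N ℤ.* (a ℤ.+ c) ≡ (M ℤ.* b ℤ.+ N ℤ.* a) ℤ.+ (M ℤ.* d ℤ.+ N ℤ.* c)
    linear = solve-∀

  level-⊕-multiple : ∀ j P → level (P ⊕ (j · (- (+ m) , + n))) ≡ level P
  level-⊕-multiple j (a , b) = invariant (+ m) (+ n) j a b
    where
    invariant : ∀ M N j a b →
      M ℤ.* (b ℤ.+ j ℤ.* N) ℤ.+ N ℤ.* (a ℤ.+ j ℤ.* (- M)) ≡ M ℤ.* b ℤ.+ N ℤ.* a
    invariant = solve-∀

  level-⊕-period : ∀ P → level (P ⊕ (- (+ m) , + n)) ≡ level P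
  level-⊕-period (a , b) = invariant (+ m) (+ n) a b
    where
    invariant : ∀ M N a b → M ℤ.* (b ℤ.+ N) ℤ.+ N ℤ.* (a ℤ.+ (- M)) ≡ M ℤ.* b ℤ.+ N ℤ.* a
    invariant = solve-∀

  level-displacement : ∀ w → level (displacement w) ≡ + (m * ups w) ℤ.- + (n * lefts w)
  level-displacement w = cong₂ ℤ._+_ (sym (ℤP.pos-* m (ups w)))
    (trans (sym (ℤP.neg-distribʳ-* (+ n) (+ lefts w))) (cong -_ (sym (ℤP.pos-* n (lefts w)))))

  level≡0⇒m*ups≡n*lefts : ∀ w → level (displacement w) ≡ 0ℤ → m * ups w ≡ n * lefts w
  level≡0⇒m*ups≡n*lefts w level≡0 =
    ℤP.+-injective (ℤP.i-j≡0⇒i≡j _ _ (trans (sym (level-displacement w)) level≡0))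

  level-multiple≡0 : ∀ k w → ups w ≡ k * n → lefts w ≡ k * m → level (displacement w) ≡ 0ℤ
  level-multiple≡0 k w ups≡ lefts≡ = trans (level-displacement w) (ℤP.i≡j⇒i-j≡0 (cong +_ (begin
    m * ups w    ≡⟨ cong (m *_) ups≡ ⟩
    m * (k * n)  ≡⟨ m*[c*n]≡n*[c*m] m k n ⟩
    n * (k * m)  ≡⟨ cong (n *_) lefts≡ ⟨
    n * lefts w  ∎)))
    where open ≡-Reasoning

  level≡0⇒period : .{{_ : NonZero n}} → Coprime n m → ∀ w → level (displacement w) ≡ 0ℤ →
    ∃[ c ] (length w ≡ c * (n + m) × ups w ≡ c * n)
  level≡0⇒period coprime w level≡0 =
    let c , ups≡ , lefts≡ = coprime-*≡*⇒multiples coprime (level≡0⇒m*ups≡n*lefts w level≡0)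
    in  c , trans (sym (ups+lefts≡length w))
                  (trans (cong₂ _+_ ups≡ lefts≡) (sym (*-distribˡ-+ c n m)))
          , ups≡

least-witness : ∀ {ℓ} {P : Pred ℕ ℓ} → Decidable P → ∀ v → ∃[ t ] (t < v × P t) →
  ∃[ t ] (t < v × P t × (∀ {t′} → t′ < t → ¬ P t′))
least-witness P? (suc v) (t , s≤s t≤v , Pt) with m≤n⇒m<n∨m≡n t≤v
... | inj₁ t<v = Product.map₂ (Product.map₁ m≤n⇒m≤1+n) (least-witness P? v (t , t<v , Pt))
... | inj₂ refl with anyUpTo? P? t
...   | yes earlier = Product.map₂ (Product.map₁ m≤n⇒m≤1+n) (least-witness P? t earlier)
...   | no  none    = t , ≤-refl , Pt , λ t′<t Pt′ → none (_ , t′<t , Pt′)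

module Revisits (n m : ℕ) (p : List Step) where
  open Level n m

  Revisit : ℕ → Set
  Revisit t = ∃[ i ] (i < t × level (D p i) ≡ level (D p t))

  revisit? : Decidable Revisit
  revisit? t = anyUpTo? (λ i → level (D p i) ℤ.≟ level (D p t)) t

  revisit-at-end : ∀ k → ups p ≡ k * n → lefts p ≡ k * m → 0 < length p → Revisit (length p)
  revisit-at-end k ups≡ lefts≡ nonempty = 0 , nonempty , (begin
    level (D p 0)                ≡⟨ level-multiple≡0 0 [] refl refl ⟩
    0ℤ                           ≡⟨ level-multiple≡0 k p ups≡ lefts≡ ⟨
    level (displacement p)       ≡⟨ cong (level ∘ displacement) (take-all (length p) p ≤-refl) ⟨
    level (D p (length p))       ∎)
    where open ≡-Reasoning

  level-segment≡0 : ∀ i d → level (D p i) ≡ level (D p (i + d)) →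
    level (displacement (take d (drop i p))) ≡ 0ℤ
  level-segment≡0 i d same = identityʳ-unique (level (D p i)) _ (begin
    level (D p i) ℤ.+ level (displacement (take d (drop i p)))  ≡⟨ level-⊕ (D p i) _ ⟨
    level (D p i ⊕ displacement (take d (drop i p)))          ≡⟨ cong level (D-+ p i d) ⟨
    level (D p (i + d))                                      ≡⟨ same ⟨
    level (D p i)                                            ∎)
    where open ≡-Reasoning

  revisit-period : .{{_ : NonZero n}} → Coprime n m → ∀ {i T} → i < T → T ≤ length p →
    level (D p i) ≡ level (D p T) →
    ∃[ c ] (i + suc c * (n + m) ≡ T × ups (take T p) ≡ ups (take i p) + suc c * n)
  revisit-period coprime {i} i<T T≤len same with m≤n⇒∃[o]m+o≡n (<⇒≤ i<T)
  ... | d , refl = positive-period (level≡0⇒period coprime w (level-segment≡0 i d same))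
    where
    w : List Step
    w = take d (drop i p)
    length≡d : length w ≡ d
    length≡d = length-take-drop i d p T≤len
    positive-period : ∃[ c ] (length w ≡ c * (n + m) × ups w ≡ c * n) →
      ∃[ c ] (i + suc c * (n + m) ≡ i + d × ups (take (i + d) p) ≡ ups (take i p) + suc c * n)
    positive-period (zero , length≡0 , _) = ⊥-elim (<-irrefl refl (≤-trans i<T (≤-reflexive
      (trans (cong (_+_ i) (trans (sym length≡d) length≡0)) (+-identityʳ i)))))
    positive-period (suc c , length≡ , ups≡) =
      c , cong (_+_ i) (trans (sym length≡) length≡d)
        , trans (ups-take-+ i d p) (cong (_+_ (ups (take i p))) ups≡)

  balanced-window : ∀ s → s + (n + m) ≤ length p → ups (take (n + m) (drop s p)) ≡ n →
    Balanced n m p s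
  balanced-window s fits ups≡n =
    fits , trans (D-+ p s (n + m))
                 (cong (D p s ⊕_) (cong₂ _,_ (cong (-_ ∘ +_) lefts≡m) (cong +_ ups≡n)))
    where
    w : List Step
    w = take (n + m) (drop s p)
    lefts≡m : lefts w ≡ m
    lefts≡m = +-cancelˡ-≡ n _ _ (trans (cong (λ u → u + lefts w) (sym ups≡n))
      (trans (ups+lefts≡length w) (length-take-drop s (n + m) p fits)))

  good-before-first-revisit : ∀ {s T} → 0 < n + m → (∀ {t} → t < T → ¬ Revisit t) →
    s + (n + m) ≤ T → Balanced n m p s → Good n m p s
  good-before-first-revisit {s} {T} nonempty first fits (_ , shift) i i<s s′ s′≤n+m j meets =
    let _ , t<T , revisit = earlier (m≤n⇒m<n∨m≡n s′≤n+m) in first t<T revisit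
    where
    same : level (D p i) ≡ level (D p (s + s′))
    same = trans (cong level meets) (level-⊕-multiple j (D p (s + s′)))
    earlier : s′ < n + m ⊎ s′ ≡ n + m → ∃[ t ] (t < T × Revisit t)
    earlier (inj₁ s′<n+m) =
      s + s′ , ≤-trans (+-monoʳ-< s s′<n+m) fits , i , ≤-trans i<s (m≤m+n s s′) , same
    earlier (inj₂ refl) = s , ≤-trans (m<m+n s nonempty) fits , i , i<s ,
      trans same (trans (cong level shift) (level-⊕-period (D p s)))

  good-interval-after-first-revisit : .{{_ : NonZero n}} → Coprime n m → ∀ {T} → T ≤ length p →
    Revisit T → (∀ {t} → t < T → ¬ Revisit t) → ∃[ r ] (Balanced n m p r × Good n m p r)
  good-interval-after-first-revisit coprime T≤len (i , i<T , same) first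
    with revisit-period coprime i<T T≤len same
  ... | c , refl , growth
    with window-≡-mean n (n + m) (ups-take-unitIncreasing p) (λ t → ups-take-+ t (n + m) p)
                       i c growth
  ... | s , fits , window≡n =
    s , balanced
      , good-before-first-revisit (≤-trans (>-nonZero⁻¹ n) (m≤m+n n m)) first fits balanced
    where
    balanced : Balanced n m p s
    balanced = balanced-window s (≤-trans fits T≤len) window≡n

mainTheorem13 : (n m k : ℕ) → 1 ≤ n → 1 ≤ m → Coprime n m → 1 ≤ k →
    (p : List Step) → IsDyck n m k p →
    ∃[ r ] (Balanced n m p r × Good n m p r)
mainTheorem13 n m k 1≤n _ coprime 1≤k p (ups≡kn , lefts≡km , _) =
  let T , T<1+len , revisit , first = least-witness revisit? (suc (length p)) end-revisit
  in  good-interval-after-first-revisit {{>-nonZero 1≤n}} coprime (s≤s⁻¹ T<1+len) revisit first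
  where
  open Revisits n m p
  nonempty : 0 < length p
  nonempty = ≤-trans (*-mono-≤ 1≤k 1≤n)
    (≤-trans (≤-reflexive (sym ups≡kn)) (≤-trans (m≤m+n _ _) (≤-reflexive (ups+lefts≡length p))))
  end-revisit : ∃[ t ] (t < suc (length p) × Revisit t)
  end-revisit = length p , ≤-refl , revisit-at-end k ups≡kn lefts≡km nonempty
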